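{- In a 2-hybrid 1-nested evolutionary network, each hybrid node is the end of exactly one reticulation cycle.
   Context: An evolutionary network is a rooted directed acyclic graph whose leaves are bijectively labeled by a set of taxa. A hybrid node is a node of in-degree at least 2; a network is 2-hybrid when every hybrid node has in-degree 2. A reticulation cycle for a hybrid node $h$ is a pair of distinct non-trivial directed paths with a common origin (the split node), both ending in $h$ (the end), that have no intermediate (non-endpoint) nodes in common; its intermediate nodes are those of the two paths. A network is 1-nested when every pair of reticulation cycles with different ends have disjoint sets of intermediate nodes. -}

module Defs where

open import Data.Nat using (ℕ; zero; suc; _+_; _≥_)
open import Data.Fin using (Fin)
open import Data.Bool using (Bool; true; false; if_then_else_; T)
open import Data.List using (List; []; _∷_; map)
open import Data.Nat.ListAction using (sum)
open import Data.List.Membership.Propositional using (_∈_)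
open import Data.Fin.Base using ()
open import Data.List using () renaming (tabulate to tabulateL)
open import Data.Product using (Σ; _×_; ∃; ∃-syntax; _,_)
open import Data.Sum using (_⊎_)
open import Data.Empty using (⊥)
open import Relation.Nullary using (¬_)
open import Relation.Binary.PropositionalEquality using (_≡_; _≢_)
open import Function.Bundles using (_⤖_)

Graph : ℕ → Set
Graph n = Fin n → Fin n → Bool

module _ {n : ℕ} (G : Graph n) where

  Arc : Fin n → Fin n → Set
  Arc u v = T (G u v)

  indeg : Fin n → ℕ
  indeg v = sum (tabulateL {n = n} (λ u → if G u v then 1 else 0))

  outdeg : Fin n → ℕ
  outdeg u = sum (tabulateL {n = n} (λ v → if G u v then 1 else 0))

  data Path : Fin n → Fin n → List (Fin n) → Set where
    edge : ∀ {u v} → Arc u v → Path u v (u ∷ v ∷ [])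
    step : ∀ {u w v xs} → Arc u w → Path w v xs → Path u v (u ∷ xs)

  Reach : Fin n → Fin n → Set
  Reach u v = u ≡ v ⊎ ∃[ xs ] Path u v xs

  Acyclic : Set
  Acyclic = ∀ v xs → ¬ Path v v xs

  Rooted : Set
  Rooted = ∃[ r ] (indeg r ≡ 0 × (∀ v → Reach r v))

  Leaf : Fin n → Set
  Leaf v = outdeg v ≡ 0

  Hybrid : Fin n → Set
  Hybrid v = indeg v ≥ 2

  TwoHybrid : Set
  TwoHybrid = ∀ v → Hybrid v → indeg v ≡ 2

inner : {A : Set} → List A → List A
inner []           = []
inner (x ∷ [])     = []
inner (x ∷ y ∷ ys) = dropLast (y ∷ ys)
  where
  dropLast : {A : Set} → List A → List A
  dropLast []           = []
  dropLast (z ∷ [])     = []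
  dropLast (z ∷ w ∷ zs) = z ∷ dropLast (w ∷ zs)

record EvoNetwork (X : Set) : Set₁ where
  field
    n        : ℕ
    G        : Graph n
    acyclic  : Acyclic G
    rooted   : Rooted G
    labelling : Σ (Fin n) (Leaf G) ⤖ X

module _ {n : ℕ} (G : Graph n) where

  record ReticCycle : Set where
    constructor retic
    field
      split end : Fin n
      p q       : List (Fin n)
      pathP     : Path G split end p
      pathQ     : Path G split end q
      distinct  : p ≢ q
      disjoint  : ∀ x → x ∈ inner p → x ∈ inner q → ⊥

  open ReticCycle public

  InCycle : Fin n → ReticCycle → Set
  InCycle x c = x ∈ inner (p c) ⊎ x ∈ inner (q c)

  OneNested : Set
  OneNested = ∀ (c d : ReticCycle) → end c ≢ end d →
              ∀ x → InCycle x c → InCycle x d → ⊥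

  -- A reticulation cycle is an (unordered) pair of paths.
  SameCycle : ReticCycle → ReticCycle → Set
  SameCycle c d = (p c ≡ p d × q c ≡ q d) ⊎ (p c ≡ q d × q c ≡ p d)

-- Existence (`cycleThrough`, acyclicity and root only): for distinct parents
-- u, v of x, cut root paths to u and v at the last node of the v-path lying
-- on the u-path.  Uniqueness: by 2-hybridity two cycles ending at h enter it
-- by the same two arcs (`align`).  By 1-nestedness an intermediate node whose
-- cycle predecessor is intermediate has no other parent (`single-parent`), so
-- walking back, corresponding sides agree until one reaches its origin
-- (`Compare`); every other way of stopping is refuted by acyclicity and
-- 1-nestedness (`no-clashes`), whence the cycles coincide (`only-cycle`).

module Submission where

open import Defs
open import Data.Product using (Σ; _×_; ∃; ∃₂; _,_; proj₁; proj₂)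
open import Data.Sum using (_⊎_; inj₁; inj₂)
open import Data.Empty using (⊥; ⊥-elim)
open import Data.Unit using (tt)
open import Data.Bool using (Bool; true; false; if_then_else_; T)
open import Data.Nat using (ℕ; suc; _≤_; s≤s; z≤n)
open import Data.Nat.Properties using (≤-trans; ≤-pred; m≤m+n; m≤n+m; +-mono-≤)
open import Data.Nat.ListAction using (sum)
open import Data.Fin using (Fin; zero; suc)
open import Data.Fin.Properties using (_≟_; suc-injective)
open import Data.List using (List; []; _∷_; _++_; reverse)
open import Data.List using () renaming (tabulate to tabulateL)
open import Data.List.Properties using (unfold-reverse; reverse-++; reverse-injective)
open import Data.List.Membership.Propositional using (_∈_)
open import Data.List.Membership.Propositional.Properties using (∈-++⁺ˡ; ∈-++⁺ʳ; ∈-++⁻)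
import Data.List.Membership.DecPropositional as DecMembership
open import Data.List.Relation.Binary.Subset.Propositional using (_⊆_)
open import Data.List.Relation.Unary.Any using (here; there)
open import Data.List.Relation.Unary.Any.Properties using (reverse⁺; reverse⁻)
open import Function using (_∘_)
open import Relation.Binary.PropositionalEquality using (_≡_; _≢_; refl; sym; trans; cong; subst)
open import Relation.Nullary using (yes; no)

inner-middle : {A : Set} (u v : A) (xs : List A) → inner (u ∷ xs ++ v ∷ []) ≡ xs
inner-middle u v []           = refl
inner-middle u v (w ∷ [])     = refl
inner-middle u v (w ∷ z ∷ xs) = cong (w ∷_) (inner-middle w v (z ∷ xs))

-- The number of points satisfying a Boolean predicate on Fin n; the
-- in-degree of v in G is `count (λ u → G u v)` by definition.
count : ∀ {n} → (Fin n → Bool) → ℕ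
count {n} g = sum (tabulateL {n = n} (λ u → if g u then 1 else 0))

indicator : ∀ {b} → T b → 1 ≤ (if b then 1 else 0)
indicator {true} _ = s≤s z≤n

count-suc : ∀ {n} (g : Fin (suc n) → Bool) → count (g ∘ suc) ≤ count g
count-suc g = m≤n+m _ _

count≥1 : ∀ {n} (g : Fin n → Bool) {i} → T (g i) → 1 ≤ count g
count≥1 g {zero}  gi = ≤-trans (indicator gi) (m≤m+n _ _)
count≥1 g {suc i} gi = ≤-trans (count≥1 (g ∘ suc) gi) (count-suc g)

count≥2 : ∀ {n} (g : Fin n → Bool) {i j} → i ≢ j → T (g i) → T (g j) → 2 ≤ count g
count≥2 g {zero}  {zero}  i≢j _  _  = ⊥-elim (i≢j refl)
count≥2 g {zero}  {suc j} _   gi gj = +-mono-≤ (indicator gi) (count≥1 (g ∘ suc) gj)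
count≥2 g {suc i} {zero}  _   gi gj = +-mono-≤ (indicator gj) (count≥1 (g ∘ suc) gi)
count≥2 g {suc i} {suc j} i≢j gi gj =
  ≤-trans (count≥2 (g ∘ suc) (i≢j ∘ cong suc) gi gj) (count-suc g)

count≥3 : ∀ {n} (g : Fin n → Bool) {i j k} → i ≢ j → i ≢ k → j ≢ k →
          T (g i) → T (g j) → T (g k) → 3 ≤ count g
count≥3 g {zero}  {zero}  {_}     i≢j _   _   _  _  _  = ⊥-elim (i≢j refl)
count≥3 g {zero}  {suc j} {zero}  _   i≢k _   _  _  _  = ⊥-elim (i≢k refl)
count≥3 g {suc i} {zero}  {zero}  _   _   j≢k _  _  _  = ⊥-elim (j≢k refl)
count≥3 g {zero}  {suc j} {suc k} _   _   j≢k gi gj gk =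
  +-mono-≤ (indicator gi) (count≥2 (g ∘ suc) (j≢k ∘ cong suc) gj gk)
count≥3 g {suc i} {zero}  {suc k} _   i≢k _   gi gj gk =
  +-mono-≤ (indicator gj) (count≥2 (g ∘ suc) (i≢k ∘ cong suc) gi gk)
count≥3 g {suc i} {suc j} {zero}  i≢j _   _   gi gj gk =
  +-mono-≤ (indicator gk) (count≥2 (g ∘ suc) (i≢j ∘ cong suc) gi gj)
count≥3 g {suc i} {suc j} {suc k} i≢j i≢k j≢k gi gj gk =
  ≤-trans (count≥3 (g ∘ suc) (i≢j ∘ cong suc) (i≢k ∘ cong suc) (j≢k ∘ cong suc) gi gj gk)
          (count-suc g)

count≥1-witness : ∀ {n} (g : Fin n → Bool) → 1 ≤ count g → ∃ λ i → T (g i)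
count≥1-witness {suc n} g c with g zero in eq
... | true  = zero , subst T (sym eq) tt
... | false with count≥1-witness (g ∘ suc) c
...   | i , gi = suc i , gi

count≥2-witnesses : ∀ {n} (g : Fin n → Bool) → 2 ≤ count g →
                    ∃₂ λ i j → i ≢ j × T (g i) × T (g j)
count≥2-witnesses {suc n} g c with g zero in eq
... | true with count≥1-witness (g ∘ suc) (≤-pred c)
...   | j , gj = zero , suc j , (λ ()) , subst T (sym eq) tt , gj
count≥2-witnesses {suc n} g c | false with count≥2-witnesses (g ∘ suc) c
...   | i , j , i≢j , gi , gj = suc i , suc j , i≢j ∘ suc-injective , gi , gj

module Cycles {n : ℕ} (G : Graph n) where

  -- A non-trivial path u ⇝ v recorded backwards: the index lists its
  -- intermediate nodes, starting with the last predecessor of v.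
  data BPath : Fin n → Fin n → List (Fin n) → Set where
    arc  : ∀ {u v} → Arc G u v → BPath u v []
    snoc : ∀ {u w v rs} → BPath u w rs → Arc G w v → BPath u v (w ∷ rs)

  _⨾_ : ∀ {u x v rs ts} → BPath u x rs → BPath x v ts → BPath u v (ts ++ x ∷ rs)
  π ⨾ arc a    = snoc π a
  π ⨾ snoc ρ a = snoc (π ⨾ ρ) a

  cut : ∀ {u v rs x} → BPath u v rs → x ∈ rs →
        ∃₂ λ rs₁ rs₂ → BPath u x rs₁ × BPath x v rs₂ × rs₁ ⊆ rs × rs₂ ⊆ rs
  cut (snoc π a) (here refl) = _ , [] , π , arc a , there , λ ()
  cut (snoc {w = w} π a) (there m) with cut π m
  ... | rs₁ , rs₂ , π₁ , π₂ , ⊆₁ , ⊆₂ =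
    rs₁ , w ∷ rs₂ , π₁ , snoc π₂ a , there ∘ ⊆₁ ,
    λ { (here refl) → here refl ; (there k) → there (⊆₂ k) }

  retarget : ∀ {u v v' rs} → v ≡ v' → BPath u v rs → BPath u v' rs
  retarget refl π = π

  reorigin : ∀ {u u' v rs} → u ≡ u' → BPath u v rs → BPath u' v rs
  reorigin refl π = π

  prefix : ∀ {u v rs x} → BPath u v rs → x ∈ rs → ∃ λ r → BPath u x r
  prefix π m with cut π m
  ... | rs₁ , _ , π₁ , _ = rs₁ , π₁

  lastPred : Fin n → List (Fin n) → Fin n
  lastPred s []      = s
  lastPred s (w ∷ _) = w

  lastArc : ∀ {s v rs} → BPath s v rs → Arc G (lastPred s rs) v
  lastArc (arc a)    = a
  lastArc (snoc _ a) = a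

  nodes : Fin n → List (Fin n) → Fin n → List (Fin n)
  nodes u rs v = u ∷ reverse rs ++ v ∷ []

  inner-nodes : ∀ u rs v → inner (nodes u rs v) ≡ reverse rs
  inner-nodes u rs v = inner-middle u v (reverse rs)

  ∈-inner⁻ : ∀ {x} u rs v → x ∈ inner (nodes u rs v) → x ∈ rs
  ∈-inner⁻ {x} u rs v m = reverse⁻ (subst (x ∈_) (inner-nodes u rs v) m)

  ∈-inner⁺ : ∀ {x} u rs v → x ∈ rs → x ∈ inner (nodes u rs v)
  ∈-inner⁺ {x} u rs v m = subst (x ∈_) (sym (inner-nodes u rs v)) (reverse⁺ m)

  nodes-injective : ∀ u v {rs ts} → nodes u rs v ≡ nodes u ts v → rs ≡ ts
  nodes-injective u v {rs} {ts} e = reverse-injective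
    (trans (sym (inner-nodes u rs v)) (trans (cong inner e) (inner-nodes u ts v)))

  nodes-cong : ∀ {u u' rs rs' v v'} → u ≡ u' → rs ≡ rs' → v ≡ v' →
               nodes u rs v ≡ nodes u' rs' v'
  nodes-cong refl refl refl = refl

  path-snoc : ∀ {u w v xs} → Path G u w xs → Arc G w v → Path G u v (xs ++ v ∷ [])
  path-snoc (edge b)   a = step b (edge a)
  path-snoc (step b π) a = step b (path-snoc π a)

  toPath : ∀ {u v rs} → BPath u v rs → Path G u v (nodes u rs v)
  toPath (arc a) = edge a
  toPath {u} {v} (snoc {w = w} {rs = rs} π a) =
    subst (λ l → Path G u v (u ∷ l ++ v ∷ [])) (sym (unfold-reverse w rs))
          (path-snoc (toPath π) a)

  fromPath : ∀ {u v xs} → Path G u v xs →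
             ∃ λ rs → BPath u v rs × xs ≡ nodes u rs v
  fromPath (edge a) = [] , arc a , refl
  fromPath {u} {v} (step {w = w} a π) with fromPath π
  ... | rs , β , eq =
    rs ++ w ∷ [] , arc a ⨾ β ,
    trans (cong (u ∷_) eq) (cong (λ l → u ∷ l ++ v ∷ []) (sym (reverse-++ rs (w ∷ []))))

  data Walk : Fin n → Fin n → List (Fin n) → Set where
    stay : ∀ {u} → Walk u u (u ∷ [])
    step : ∀ {u w v ns} → Walk u w ns → Arc G w v → Walk u v (v ∷ ns)

  walk-start∈ : ∀ {u v ns} → Walk u v ns → u ∈ ns
  walk-start∈ stay       = here refl
  walk-start∈ (step β _) = there (walk-start∈ β)

  walkOf : ∀ {u v rs} → BPath u v rs → ∃ (Walk u v)
  walkOf (arc a)    = _ , step stay a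
  walkOf (snoc π a) = _ , step (proj₂ (walkOf π)) a

  walkOfReach : ∀ {u v} → Reach G u v → ∃ (Walk u v)
  walkOfReach (inj₁ refl)    = _ , stay
  walkOfReach (inj₂ (_ , π)) = walkOf (proj₁ (proj₂ (fromPath π)))

  suffix : ∀ {r u ns z} → Walk r u ns → z ∈ ns → ∃ λ ms → Walk z u ms × ms ⊆ ns
  suffix stay       (here refl) = _ , stay , λ m → m
  suffix (step β a) (here refl) = _ , stay , λ { (here refl) → here refl }
  suffix (step β a) (there m) with suffix β m
  ... | ms , β' , ms⊆ = _ , step β' a , λ { (here refl) → here refl ; (there k) → there (ms⊆ k) }

  extend : ∀ {z u x ms} → Walk z u ms → Arc G u x →
           ∃ λ rs → BPath z x rs × rs ⊆ ms × (u ∈ rs ⊎ z ≡ u)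
  extend stay a = [] , arc a , (λ ()) , inj₂ refl
  extend (step β b) a with extend β b
  ... | rs , π , rs⊆ , _ =
    _ ∷ rs , snoc π a , (λ { (here refl) → here refl ; (there k) → there (rs⊆ k) }) , inj₁ (here refl)

  open DecMembership (_≟_ {n}) using (_∈?_)

  lastMeet : ∀ {r v ms} (N : List (Fin n)) → r ∈ N → Walk r v ms →
             Σ (Fin n) λ z → ∃ λ ms' → Walk z v ms' × (∀ {w} → w ∈ ms' → w ∈ N → w ≡ z) × z ∈ N
  lastMeet {v = v} N r∈N β with v ∈? N
  ... | yes v∈N = v , _ , stay , (λ { (here refl) _ → refl }) , v∈N
  lastMeet N r∈N stay       | no v∉N = ⊥-elim (v∉N r∈N)
  lastMeet N r∈N (step β a) | no v∉N with lastMeet N r∈N β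
  ... | z , _ , β' , avoid , z∈N =
    z , _ , step β' a , (λ { (here refl) k → ⊥-elim (v∉N k) ; (there j) k → avoid j k }) , z∈N

  record Cycle : Set where
    field
      origin target : Fin n
      left right    : List (Fin n)
      left-path     : BPath origin target left
      right-path    : BPath origin target right
      apart         : ∀ x → x ∈ left → x ∈ right → ⊥
      differ        : left ≢ right

  open Cycle

  swap : Cycle → Cycle
  swap C = record
    { origin = origin C ; target = target C ; left = right C ; right = left C
    ; left-path = right-path C ; right-path = left-path C
    ; apart = λ x r l → apart C x l r ; differ = differ C ∘ sym }

  Inner : Fin n → Cycle → Set
  Inner x C = x ∈ left C ⊎ x ∈ right C

  OnLeft OnRight : Fin n → Cycle → Set
  OnLeft  u E = u ∈ left E  ⊎ origin E ≡ u
  OnRight u E = u ∈ right E ⊎ origin E ≡ u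

  SameSides : Cycle → Cycle → Set
  SameSides C D = origin C ≡ origin D × left C ≡ left D × right C ≡ right D

  toRetic : Cycle → ReticCycle G
  toRetic C =
    retic (origin C) (target C) _ _ (toPath (left-path C)) (toPath (right-path C))
          (differ C ∘ nodes-injective (origin C) (target C))
          (λ x l r → apart C x (∈-inner⁻ _ _ _ l) (∈-inner⁻ _ _ _ r))

  fromRetic : (d : ReticCycle G) →
              Σ Cycle λ C → target C ≡ end d
                          × p d ≡ nodes (origin C) (left C) (target C)
                          × q d ≡ nodes (origin C) (right C) (target C)
  fromRetic d with fromPath (pathP d) | fromPath (pathQ d)
  ... | ls , βl , eL | rs , βr , eR =
    record
      { origin = split d ; target = end d ; left = ls ; right = rs
      ; left-path = βl ; right-path = βr
      ; apart = λ x l r → disjoint d x (subst (λ xs → x ∈ inner xs) (sym eL) (∈-inner⁺ _ _ _ l))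
                                       (subst (λ xs → x ∈ inner xs) (sym eR) (∈-inner⁺ _ _ _ r))
      ; differ = λ e → distinct d (trans eL (trans (cong (λ l → nodes (split d) l (end d)) e) (sym eR)))
      }
    , refl , eL , eR

  reroute : ∀ {y x t} (C : Cycle) → y ∈ left C → x ∈ left C → BPath y x t →
            (∀ w → w ∈ t → w ∈ right C → ⊥) →
            Σ Cycle λ C' → target C' ≡ target C × t ⊆ left C'
  reroute {y} {x} {t} C y∈C x∈C detour t-apart
    with cut (left-path C) y∈C | cut (left-path C) x∈C
  ... | before , _ , to-y , _ , before⊆ , _ | _ , after , _ , from-x , _ , after⊆ =
    C' , refl , λ m → ∈-++⁺ʳ after (there (∈-++⁺ˡ m))
    where
    newLeft : List (Fin n)
    newLeft = after ++ x ∷ t ++ y ∷ before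

    pieces : ∀ {w} → w ∈ newLeft → w ∈ left C ⊎ w ∈ t
    pieces m with ∈-++⁻ after m
    ... | inj₁ k = inj₁ (after⊆ k)
    ... | inj₂ (here refl) = inj₁ x∈C
    ... | inj₂ (there k) with ∈-++⁻ t k
    ...   | inj₁ k′ = inj₂ k′
    ...   | inj₂ (here refl) = inj₁ y∈C
    ...   | inj₂ (there k′) = inj₁ (before⊆ k′)

    newApart : ∀ w → w ∈ newLeft → w ∈ right C → ⊥
    newApart w m r with pieces m
    ... | inj₁ l = apart C w l r
    ... | inj₂ k = t-apart w k r

    C' : Cycle
    C' = record
      { origin = origin C ; target = target C ; left = newLeft ; right = right C
      ; left-path = (to-y ⨾ detour) ⨾ from-x ; right-path = right-path C
      ; apart = newApart
      ; differ = λ e → apart C x x∈C (subst (x ∈_) e (∈-++⁺ʳ after (here refl))) }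

  module Acyclicity (acyclic : Acyclic G) where

    no-cycle : ∀ {u rs} → BPath u u rs → ⊥
    no-cycle {u} π = acyclic u _ (toPath π)

    no-round-trip : ∀ {a b rs ts} → BPath a b rs → BPath b a ts → ⊥
    no-round-trip π ρ = no-cycle (π ⨾ ρ)

    origin∉ : ∀ {u v rs} → BPath u v rs → u ∈ rs → ⊥
    origin∉ π m = no-cycle (proj₂ (prefix π m))

    target∉ : ∀ {u v rs} → BPath u v rs → v ∈ rs → ⊥
    target∉ π m with cut π m
    ... | _ , _ , _ , loop , _ = no-cycle loop

    inner≢target : ∀ {x} (C : Cycle) → Inner x C → x ≢ target C
    inner≢target C (inj₁ m) refl = target∉ (left-path C) m
    inner≢target C (inj₂ m) refl = target∉ (right-path C) m

    reachInner : ∀ {x} (C : Cycle) → Inner x C → ∃ (BPath (origin C) x)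
    reachInner C (inj₁ m) = prefix (left-path C) m
    reachInner C (inj₂ m) = prefix (right-path C) m

    lastPreds-differ : (C : Cycle) → lastPred (origin C) (left C) ≢ lastPred (origin C) (right C)
    lastPreds-differ C = differ′ (left-path C) (right-path C) (apart C) (differ C)
      where
      differ′ : ∀ {s h rs ts} → BPath s h rs → BPath s h ts →
                (∀ x → x ∈ rs → x ∈ ts → ⊥) → rs ≢ ts → lastPred s rs ≢ lastPred s ts
      differ′ (arc _)    (arc _)    _   rs≢ts _    = rs≢ts refl
      differ′ (snoc π a) (arc _)    _   _     refl = origin∉ (snoc π a) (here refl)
      differ′ (arc _)    (snoc ρ a) _   _     refl = origin∉ (snoc ρ a) (here refl)
      differ′ (snoc _ _) (snoc _ _) dis _     refl = dis _ (here refl) (here refl)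

    module Existence (rooted : Rooted G) where

      cycleThrough : ∀ {x u v} → Arc G u x → Arc G v x → u ≢ v →
                     Σ Cycle λ E → target E ≡ x × OnLeft u E × OnRight v E
      cycleThrough {x} {u} {v} ux vx u≢v
        with walkOfReach (proj₂ (proj₂ rooted) u) | walkOfReach (proj₂ (proj₂ rooted) v)
      ... | nsU , toU | _ , toV with lastMeet nsU (walk-start∈ toU) toV
      ... | z , _ , zV , avoidU , z∈U with suffix toU z∈U
      ... | _ , zU , zU⊆ with extend zU ux | extend zV vx
      ... | ls , pathL , ls⊆ , onL | rs , pathR , rs⊆ , onR =
        E , refl , onL , onR
        where
        sidesApart : ∀ w → w ∈ ls → w ∈ rs → ⊥
        sidesApart w l r with avoidU (rs⊆ r) (zU⊆ (ls⊆ l))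
        ... | refl = origin∉ pathR r

        sidesDiffer : ls ≢ rs
        sidesDiffer e = refute onL onR
          where
          refute : u ∈ ls ⊎ z ≡ u → v ∈ rs ⊎ z ≡ v → ⊥
          refute (inj₁ u∈ls) _           = sidesApart u u∈ls (subst (u ∈_) e u∈ls)
          refute (inj₂ _)    (inj₁ v∈rs) = sidesApart v (subst (v ∈_) (sym e) v∈rs) v∈rs
          refute (inj₂ z≡u)  (inj₂ z≡v)  = u≢v (trans (sym z≡u) z≡v)

        E : Cycle
        E = record
          { origin = z ; target = x ; left = ls ; right = rs
          ; left-path = pathL ; right-path = pathR
          ; apart = sidesApart ; differ = sidesDiffer }

      module OneNestedness (oneNested : OneNested G) where

        nested : ∀ {x} (C D : Cycle) → target C ≢ target D → Inner x C → Inner x D → ⊥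
        nested {x} C D ends x∈C x∈D =
          oneNested (toRetic C) (toRetic D) ends x
            (inner⁺ (left C) (right C) x∈C) (inner⁺ (left D) (right D) x∈D)
          where
          inner⁺ : ∀ {o t} ls rs → x ∈ ls ⊎ x ∈ rs →
                   x ∈ inner (nodes o ls t) ⊎ x ∈ inner (nodes o rs t)
          inner⁺ ls rs (inj₁ m) = inj₁ (∈-inner⁺ _ ls _ m)
          inner⁺ ls rs (inj₂ m) = inj₂ (∈-inner⁺ _ rs _ m)

        single-parent : ∀ {x y y'} (C : Cycle) → x ∈ left C → y ∈ left C →
                        Arc G y x → Arc G y' x → y' ≢ y → ⊥
        single-parent {x} {y} {y'} C x∈C y∈C yx y'x y'≢y
          with cycleThrough yx y'x (y'≢y ∘ sym)
        ... | E , refl , onL , onR = refute onL onR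
          where
          ends : target C ≢ target E
          ends e = inner≢target C (inj₁ x∈C) (sym e)

          refute : OnLeft y E → OnRight y' E → ⊥
          refute (inj₁ y∈E)  _            = nested C E ends (inj₁ y∈C) (inj₁ y∈E)
          refute (inj₂ o≡y)  (inj₂ o≡y')  = y'≢y (trans (sym o≡y') o≡y)
          refute (inj₂ o≡y)  (inj₁ y'∈E)
            with reroute C y∈C x∈C (reorigin o≡y (right-path E))
                         (λ w e c → nested C E ends (inj₂ c) (inj₂ e))
          ... | C' , same-target , right⊆ =
            nested C' E (ends ∘ trans (sym same-target)) (inj₁ (right⊆ y'∈E)) (inj₂ y'∈E)

        fork-vs-inner : ∀ {s z} (C : Cycle) → Inner s C → Inner z C →
                        Arc G (origin C) z → Arc G s z → origin C ≢ s → ⊥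
        fork-vs-inner {s} C s∈C z∈C oz sz o≢s with cycleThrough oz sz o≢s
        ... | E , refl , onL , onR = refute onL onR
          where
          refute : OnLeft (origin C) E → OnRight s E → ⊥
          refute _          (inj₁ s∈E) = nested C E (inner≢target C z∈C ∘ sym) s∈C (inj₂ s∈E)
          refute (inj₂ e₁)  (inj₂ e₂)  = o≢s (trans (sym e₁) e₂)
          refute (inj₁ o∈E) (inj₂ e₂)  =
            no-round-trip (reorigin e₂ (proj₂ (prefix (left-path E) o∈E)))
                          (proj₂ (reachInner C s∈C))

        two-forks : ∀ {s s' x z} → x ≢ z → Arc G s x → Arc G s' x → Arc G s z → Arc G s' z →
                    s ≢ s' → ⊥
        two-forks {s} {s'} x≢z sx s'x sz s'z s≢s'
          with cycleThrough sx s'x s≢s' | cycleThrough sz s'z s≢s'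
        ... | E , refl , eL , eR | F , refl , fL , fR = refute eL eR fL fR
          where
          refute : OnLeft s E → OnRight s' E → OnLeft s F → OnRight s' F → ⊥
          refute (inj₁ a) _ (inj₁ b) _ = nested E F x≢z (inj₁ a) (inj₁ b)
          refute _ (inj₁ a) _ (inj₁ b) = nested E F x≢z (inj₂ a) (inj₂ b)
          refute (inj₂ e₁) (inj₂ e₂) _ _ = s≢s' (trans (sym e₁) e₂)
          refute _ _ (inj₂ f₁) (inj₂ f₂) = s≢s' (trans (sym f₁) f₂)
          refute (inj₁ a) (inj₂ e₂) (inj₂ f₁) (inj₁ b) =
            no-round-trip (reorigin e₂ (proj₂ (prefix (left-path E) a)))
                          (reorigin f₁ (proj₂ (prefix (right-path F) b)))
          refute (inj₂ e₁) (inj₁ a) (inj₁ b) (inj₂ f₂) =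
            no-round-trip (reorigin e₁ (proj₂ (prefix (right-path E) a)))
                          (reorigin f₂ (proj₂ (prefix (left-path F) b)))

        -- Ways in which backward walks along the left sides of C and D,
        -- agreeing so far, can end at different origins.
        data Clash (C D : Cycle) : Set where
          originD∈C : origin D ∈ left C → Clash C D
          originC∈D : origin C ∈ left D → Clash C D
          fork      : ∀ {x} → x ∈ left C → x ∈ left D →
                      Arc G (origin C) x → Arc G (origin D) x → origin C ≢ origin D → Clash C D

        clash-origins : ∀ {C D} → Clash C D → origin C ≢ origin D
        clash-origins {C} (originD∈C m) refl = origin∉ (left-path C) m
        clash-origins {C} {D} (originC∈D m) refl = origin∉ (left-path D) m
        clash-origins (fork _ _ _ _ o≢o) = o≢o

        no-clashes : ∀ {C D} → Clash C D → Clash (swap C) (swap D) → ⊥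
        no-clashes {C} (originD∈C a) (originD∈C b) = apart C _ a b
        no-clashes {C} {D} (originD∈C a) (originC∈D b) =
          no-round-trip (proj₂ (prefix (left-path C) a)) (proj₂ (prefix (right-path D) b))
        no-clashes {C} (originD∈C a) (fork zC _ oz o'z o≢o) = fork-vs-inner C (inj₁ a) (inj₂ zC) oz o'z o≢o
        no-clashes {C} {D} (originC∈D a) (originD∈C b) =
          no-round-trip (proj₂ (prefix (left-path D) a)) (proj₂ (prefix (right-path C) b))
        no-clashes {D = D} (originC∈D a) (originC∈D b) = apart D _ a b
        no-clashes {D = D} (originC∈D a) (fork _ zD oz o'z o≢o) =
          fork-vs-inner D (inj₁ a) (inj₂ zD) o'z oz (o≢o ∘ sym)
        no-clashes {C} (fork xC _ ox o'x o≢o) (originD∈C b) = fork-vs-inner C (inj₂ b) (inj₁ xC) ox o'x o≢o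
        no-clashes {D = D} (fork _ xD ox o'x o≢o) (originC∈D b) =
          fork-vs-inner D (inj₂ b) (inj₁ xD) o'x ox (o≢o ∘ sym)
        no-clashes {C} (fork xC _ ox o'x o≢o) (fork zC _ oz o'z _) =
          two-forks (λ x≡z → apart C _ xC (subst (_∈ right C) (sym x≡z) zC)) ox o'x oz o'z o≢o

        module Compare (C D : Cycle) where

          data Meet (rc rd : List (Fin n)) : Set where
            agree : origin C ≡ origin D → rc ≡ rd → Meet rc rd
            clash : Clash C D → Meet rc rd

          grow : ∀ {rc rd} w → Meet rc rd → Meet (w ∷ rc) (w ∷ rd)
          grow w (agree o≡o rc≡rd) = agree o≡o (cong (w ∷_) rc≡rd)
          grow w (clash c)         = clash c

          walk : ∀ {x rc rd} → BPath (origin C) x rc → BPath (origin D) x rd →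
                 x ∈ left C → x ∈ left D → rc ⊆ left C → rd ⊆ left D → Meet rc rd
          walk (arc a) (arc b) xC xD _ _ with origin C ≟ origin D
          ... | yes o≡o = agree o≡o refl
          ... | no o≢o  = clash (fork xC xD a b o≢o)
          walk (snoc {w = w} _ a) (arc b) xC _ ⊆C _ with origin D ≟ w
          ... | yes refl = clash (originD∈C (⊆C (here refl)))
          ... | no o≢w   = ⊥-elim (single-parent C xC (⊆C (here refl)) a b o≢w)
          walk (arc a) (snoc {w = w} _ b) _ xD _ ⊆D with origin C ≟ w
          ... | yes refl = clash (originC∈D (⊆D (here refl)))
          ... | no o≢w   = ⊥-elim (single-parent D xD (⊆D (here refl)) b a o≢w)
          walk (snoc {w = w} π a) (snoc {w = w'} ρ b) xC _ ⊆C ⊆D with w' ≟ w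
          ... | no w'≢w = ⊥-elim (single-parent C xC (⊆C (here refl)) a b w'≢w)
          ... | yes refl =
            grow w (walk π ρ (⊆C (here refl)) (⊆D (here refl)) (⊆C ∘ there) (⊆D ∘ there))

          start : ∀ {h rc rd} → BPath (origin C) h rc → BPath (origin D) h rd →
                  rc ⊆ left C → rd ⊆ left D →
                  lastPred (origin C) rc ≡ lastPred (origin D) rd → Meet rc rd
          start (arc _) (arc _) _ _ o≡o = agree o≡o refl
          start (snoc _ _) (arc _) ⊆C _ refl = clash (originD∈C (⊆C (here refl)))
          start (arc _) (snoc _ _) _ ⊆D refl = clash (originC∈D (⊆D (here refl)))
          start (snoc {w = w} π _) (snoc ρ _) ⊆C ⊆D refl =
            grow w (walk π ρ (⊆C (here refl)) (⊆D (here refl)) (⊆C ∘ there) (⊆D ∘ there))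

        resolve : (C D : Cycle) → Compare.Meet C D (left C) (left D) →
                  Compare.Meet (swap C) (swap D) (right C) (right D) → SameSides C D
        resolve C D (Compare.agree o≡o l≡l) (Compare.agree _ r≡r) = o≡o , l≡l , r≡r
        resolve C D (Compare.agree o≡o _)   (Compare.clash c)     = ⊥-elim (clash-origins c o≡o)
        resolve C D (Compare.clash c)       (Compare.agree o≡o _) = ⊥-elim (clash-origins c o≡o)
        resolve C D (Compare.clash c)       (Compare.clash c′)    = ⊥-elim (no-clashes c c′)

        sides-agree : (C D : Cycle) → target D ≡ target C →
                      lastPred (origin C) (left C) ≡ lastPred (origin D) (left D) →
                      lastPred (origin C) (right C) ≡ lastPred (origin D) (right D) →
                      SameSides C D
        sides-agree C D t≡t preds-left preds-right = resolve C D
          (Compare.start C D (left-path C) (retarget t≡t (left-path D)) (λ m → m) (λ m → m) preds-left)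
          (Compare.start (swap C) (swap D) (right-path C) (retarget t≡t (right-path D))
                         (λ m → m) (λ m → m) preds-right)

        module TwoHybridity (twoHybrid : TwoHybrid G) where

          no-three-parents : ∀ {h a b c} → a ≢ b → a ≢ c → b ≢ c →
                             Arc G a h → Arc G b h → Arc G c h → ⊥
          no-three-parents {h} a≢b a≢c b≢c ah bh ch
            with subst (3 ≤_) (twoHybrid h (count≥2 (λ u → G u h) a≢b ah bh))
                       (count≥3 (λ u → G u h) a≢b a≢c b≢c ah bh ch)
          ... | s≤s (s≤s ())

          parent-of-two : ∀ {h a b c} → a ≢ b → Arc G a h → Arc G b h → Arc G c h → c ≡ a ⊎ c ≡ b
          parent-of-two {a = a} {b} {c} a≢b ah bh ch with c ≟ a | c ≟ b
          ... | yes c≡a | _       = inj₁ c≡a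
          ... | no _    | yes c≡b = inj₂ c≡b
          ... | no c≢a  | no c≢b  = ⊥-elim (no-three-parents a≢b (c≢a ∘ sym) (c≢b ∘ sym) ah bh ch)

          align : ∀ {h a b a' b'} → a ≢ b → a' ≢ b' →
                  Arc G a h → Arc G b h → Arc G a' h → Arc G b' h →
                  (a' ≡ a × b' ≡ b) ⊎ (a' ≡ b × b' ≡ a)
          align a≢b a'≢b' ah bh a'h b'h
            with parent-of-two a≢b ah bh a'h | parent-of-two a≢b ah bh b'h
          ... | inj₁ e₁ | inj₂ e₂ = inj₁ (e₁ , e₂)
          ... | inj₂ e₁ | inj₁ e₂ = inj₂ (e₁ , e₂)
          ... | inj₁ e₁ | inj₁ e₂ = ⊥-elim (a'≢b' (trans e₁ (sym e₂)))
          ... | inj₂ e₁ | inj₂ e₂ = ⊥-elim (a'≢b' (trans e₁ (sym e₂)))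

          unique : (C D : Cycle) → target D ≡ target C → SameSides C D ⊎ SameSides C (swap D)
          unique C D t≡t
            with align (lastPreds-differ C) (lastPreds-differ D)
                       (lastArc (left-path C)) (lastArc (right-path C))
                       (subst (Arc G _) t≡t (lastArc (left-path D)))
                       (subst (Arc G _) t≡t (lastArc (right-path D)))
          ... | inj₁ (e₁ , e₂) = inj₁ (sides-agree C D t≡t (sym e₁) (sym e₂))
          ... | inj₂ (e₁ , e₂) = inj₂ (sides-agree C (swap D) t≡t (sym e₂) (sym e₁))

          only-cycle : (C : Cycle) (d : ReticCycle G) → end d ≡ target C → SameCycle G (toRetic C) d
          only-cycle C d end≡t with fromRetic d
          ... | D , t≡end , eP , eQ = match (unique C D t≡t)
            where
            t≡t : target D ≡ target C
            t≡t = trans t≡end end≡t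

            same : ∀ {rs rs' xs} → origin C ≡ origin D → rs ≡ rs' →
                   xs ≡ nodes (origin D) rs' (target D) → nodes (origin C) rs (target C) ≡ xs
            same o≡o rs≡rs' e = trans (nodes-cong o≡o rs≡rs' (sym t≡t)) (sym e)

            match : SameSides C D ⊎ SameSides C (swap D) → SameCycle G (toRetic C) d
            match (inj₁ (o≡o , l≡l , r≡r)) = inj₁ (same o≡o l≡l eP , same o≡o r≡r eQ)
            match (inj₂ (o≡o , l≡r , r≡l)) = inj₂ (same o≡o l≡r eQ , same o≡o r≡l eP)

lemma4 : ∀ {X : Set} (N : EvoNetwork X) →
         TwoHybrid (EvoNetwork.G N) → OneNested (EvoNetwork.G N) →
         ∀ h → Hybrid (EvoNetwork.G N) h →
         Σ (ReticCycle (EvoNetwork.G N)) λ c →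
           (end c ≡ h) ×
           (∀ d → end d ≡ h → SameCycle (EvoNetwork.G N) c d)
lemma4 N twoHybrid oneNested = cycleAt
  where
  open EvoNetwork N
  open Cycles G
  open Acyclicity acyclic
  open Existence rooted
  open OneNestedness oneNested
  open TwoHybridity twoHybrid

  cycleAt : ∀ h → Hybrid G h →
            Σ (ReticCycle G) λ c → end c ≡ h × (∀ d → end d ≡ h → SameCycle G c d)
  cycleAt h hybrid with count≥2-witnesses (λ u → G u h) hybrid
  ... | a , b , a≢b , ah , bh with cycleThrough ah bh a≢b
  ...   | E , refl , _ , _ = toRetic E , refl , only-cycle E
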